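{- Let $p(j)=\binom{j+5}{5}$. The largest positive integer $n$ that cannot be written as $n=\sum_{j\in S}\binom{j+5}{5}$ for some finite set $S$ of integers $j\ge 1$ is $291217$. In other words, $291217$ has no such representation, and every integer $n>291217$ has one.
   Context: A representation of $n$ as a sum of distinct values of $p(j)$ with $j\ge j_0$ means a finite set $S$ of integers, each $\ge j_0$, such that $n=\sum_{j\in S}p(j)$. Since each index is used at most once, the summands are distinct values. Here $j_0=1$, so the value $p(0)=1$ is excluded. -}

module Defs where

open import Data.Nat using (ℕ; _+_; _≤_)
open import Data.Nat.Combinatorics using (_C_)
open import Data.List using (List; map)
open import Data.Nat.ListAction using (sum)
open import Data.List.Relation.Unary.All using (All)
open import Data.List.Relation.Unary.Unique.Propositional using (Unique)
open import Data.Product using (∃; _×_)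
open import Relation.Binary.PropositionalEquality using (_≡_)

p : ℕ → ℕ
p j = (j + 5) C 5

Representable : ℕ → Set
Representable n =
  ∃ λ (S : List ℕ) → Unique S × All (1 ≤_) S × sum (map p S) ≡ n

module Submission where

-- If indices ≤ k
-- represent every n in [l, u] and l + p (k + 1) ≤ u + 1, then using p (k + 1) or not covers
-- [l, u + p (k + 1)] with indices ≤ k + 1 (Richert's lemma).  Since p (j + 1) ≤ 2 p j for j ≥ 4,
-- the side condition then holds again at k + 1, so by induction every n ≥ l is representable.
-- A computation with interval lists shows that indices ≤ 26 cover [291218, 492593], and
-- 492593 = 291218 + p 27 − 1.  Conversely 291217 < p 30, so a representation of 291217 only
-- uses indices ≤ 29, and an exhaustive search over these summands finds none.

open import Defs
open import Data.Nat using (ℕ; _<_)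
open import Data.Product using (_×_)
open import Relation.Nullary using (¬_)

open import Data.Bool.Base using (Bool; true; T; _∧_; _∨_)
open import Data.Bool.Properties using (T-∧; T-∨)
open import Data.List.Base using (List; []; _∷_; map; filter; merge)
open import Data.List.Properties using (filter-all; filter-accept; filter-reject)
open import Data.List.Relation.Binary.Permutation.Propositional using (↭-sym)
open import Data.List.Relation.Binary.Permutation.Propositional.Properties using (All-resp-↭; merge-↭)
open import Data.List.Relation.Unary.All as All using (All; []; _∷_; lookupWith)
open import Data.List.Relation.Unary.All.Properties using (all-filter; filter⁺; map⁺; ++⁺)
open import Data.List.Relation.Unary.AllPairs using ([]; _∷_)
open import Data.List.Relation.Unary.Any using (Any; any?)
open import Data.List.Relation.Unary.Unique.Propositional using (Unique)
import Data.List.Relation.Unary.Unique.Propositional.Properties as Unique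
open import Data.Nat.Base
open import Data.Nat.Combinatorics using (_C_; _P_; nCk≡nPk/k!; nCk+nC[k+1]≡[n+1]C[k+1])
open import Data.Nat.Combinatorics.Base using (_P′_)
open import Data.Nat.Combinatorics.Specification using (k!∣nP′k)
open import Data.Nat.DivMod using (_/_; m/n*n≡m)
open import Data.Nat.ListAction using (sum)
open import Data.Nat.Properties
open import Data.Nat.Tactic.RingSolver using (solve-∀)
open import Algebra.Properties.CommutativeSemigroup +-commutativeSemigroup using (x∙yz≈y∙xz)
open import Data.Product using (∃; _,_)
open import Data.Sum using (_⊎_; inj₁; inj₂; [_,_])
open import Function using (_∘_; Equivalence)
open import Relation.Binary.PropositionalEquality hiding ([_])
open import Relation.Nullary using (Dec; yes; no; ¬?; _×-dec_; toWitness; contradiction)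

open Equivalence using (from)

nPk≡nP′k : ∀ {n k} → k ≤ n → n P k ≡ n P′ k
nPk≡nP′k {n} {k} k≤n with k ≤ᵇ n | ≤⇒≤ᵇ k≤n
... | true | _ = refl

nCk*k!≡nP′k : ∀ {n k} → k ≤ n → (n C k) * k ! ≡ n P′ k
nCk*k!≡nP′k {n} {k} k≤n = begin
  (n C k) * k !        ≡⟨ cong (_* k !) (nCk≡nPk/k! k≤n) ⟩
  (n P k) / k ! * k !  ≡⟨ cong (λ m → m / k ! * k !) (nPk≡nP′k k≤n) ⟩
  (n P′ k) / k ! * k ! ≡⟨ m/n*n≡m (k!∣nP′k k≤n) ⟩
  n P′ k               ∎
  where
  open ≡-Reasoning
  instance _ = k !≢0

p-closedForm : ∀ j → p j * 120 ≡ (j + 1) * (j + 2) * (j + 3) * (j + 4) * (j + 5)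
p-closedForm j = begin
  ((j + 5) C 5) * 120 ≡⟨ cong (λ n → (n C 5) * 120) (+-comm j 5) ⟩
  ((5 + j) C 5) * 5 ! ≡⟨ nCk*k!≡nP′k (m≤m+n 5 j) ⟩
  (1 + j) * ((2 + j) * ((3 + j) * ((4 + j) * ((5 + j) * 1)))) ≡⟨ reorder j ⟩
  (j + 1) * (j + 2) * (j + 3) * (j + 4) * (j + 5) ∎
  where
  open ≡-Reasoning
  reorder : ∀ j → (1 + j) * ((2 + j) * ((3 + j) * ((4 + j) * ((5 + j) * 1))))
                ≡ (j + 1) * (j + 2) * (j + 3) * (j + 4) * (j + 5)
  reorder = solve-∀

-- p (suc j) / p j = (j + 6) / (j + 1).
p-suc≤2*p : ∀ {j} → 4 ≤ j → p (suc j) ≤ 2 * p j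
p-suc≤2*p {j} 4≤j = *-cancelʳ-≤ (p (suc j)) (2 * p j) 120 (begin
  p (suc j) * 120                           ≡⟨ p-closedForm (suc j) ⟩
  (suc j + 1) * (suc j + 2) * (suc j + 3) * (suc j + 4) * (suc j + 5) ≡⟨ lhs j ⟩
  (6 + j) * q                               ≤⟨ *-monoˡ-≤ q (+-monoʳ-≤ 2 (+-monoˡ-≤ j 4≤j)) ⟩
  (2 + (j + j)) * q                         ≡⟨ rhs j ⟩
  2 * ((j + 1) * (j + 2) * (j + 3) * (j + 4) * (j + 5)) ≡⟨ cong (2 *_) (p-closedForm j) ⟨
  2 * (p j * 120)                           ≡⟨ *-assoc 2 (p j) 120 ⟨
  2 * p j * 120                             ∎)
  where
  open ≤-Reasoning
  q = (j + 2) * (j + 3) * (j + 4) * (j + 5)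
  lhs : ∀ j → (suc j + 1) * (suc j + 2) * (suc j + 3) * (suc j + 4) * (suc j + 5)
            ≡ (6 + j) * ((j + 2) * (j + 3) * (j + 4) * (j + 5))
  lhs = solve-∀
  rhs : ∀ j → (2 + (j + j)) * ((j + 2) * (j + 3) * (j + 4) * (j + 5))
            ≡ 2 * ((j + 1) * (j + 2) * (j + 3) * (j + 4) * (j + 5))
  rhs = solve-∀

p-≤-suc : ∀ j → p j ≤ p (suc j)
p-≤-suc j = subst (p j ≤_) (nCk+nC[k+1]≡[n+1]C[k+1] (j + 5) 4) (m≤n+m (p j) ((j + 5) C 4))

p-mono-≤ : ∀ {i j} → i ≤ j → p i ≤ p j
p-mono-≤ i≤j = go (≤⇒≤′ i≤j)
  where
  go : ∀ {i j} → i ≤′ j → p i ≤ p j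
  go ≤′-refl                    = ≤-refl
  go {j = suc j} (≤′-step i≤′j) = ≤-trans (go i≤′j) (p-≤-suc j)

p-positive : ∀ j → 1 ≤ p j
p-positive j = p-mono-≤ (z≤n {j})

Representable≤ : ℕ → ℕ → Set
Representable≤ k n =
  ∃ λ (S : List ℕ) → Unique S × All (1 ≤_) S × All (_≤ k) S × sum (map p S) ≡ n

representable≤⇒representable : ∀ {k n} → Representable≤ k n → Representable n
representable≤⇒representable (S , u , pos , _ , e) = S , u , pos , e

representable≤-weaken : ∀ {k n} → Representable≤ k n → Representable≤ (suc k) n
representable≤-weaken (S , u , pos , bnd , e) = S , u , pos , All.map m≤n⇒m≤1+n bnd , e

representable≤-add : ∀ {k n} → Representable≤ k n → Representable≤ (suc k) (p (suc k) + n)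
representable≤-add {k} (S , u , pos , bnd , e) =
  suc k ∷ S , All.map (λ j≤k e → 1+n≰n (subst (_≤ k) (sym e) j≤k)) bnd ∷ u ,
  s≤s z≤n ∷ pos , ≤-refl ∷ All.map m≤n⇒m≤1+n bnd , cong (p (suc k) +_) e

representable≤-zero⁻ : ∀ {n} → Representable≤ 0 n → n ≡ 0
representable≤-zero⁻ ([]    , _ , _         , _         , e) = sym e
representable≤-zero⁻ (_ ∷ _ , _ , 1≤j ∷ _ , j≤0 ∷ _ , _) = contradiction (≤-trans 1≤j j≤0) λ ()

_≢?_ : ∀ (y x : ℕ) → Dec (y ≢ x)
y ≢? x = ¬? (y ≟ x)

remove : ℕ → List ℕ → List ℕ
remove x = filter (_≢? x)

sum-remove : ∀ x {S} → Unique S →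
  sum (map p S) ≡ sum (map p (remove x S)) ⊎ sum (map p S) ≡ p x + sum (map p (remove x S))
sum-remove x {[]}     []         = inj₁ refl
sum-remove x {y ∷ ys} (y∉ys ∷ u) with y ≟ x
... | yes refl = inj₂ (cong (λ zs → p y + sum (map p zs)) (sym (begin
  remove y (y ∷ ys) ≡⟨ filter-reject (_≢? y) (λ y≢y → y≢y refl) ⟩
  remove y ys       ≡⟨ filter-all (_≢? y) (All.map ≢-sym y∉ys) ⟩
  ys                ∎)))
  where open ≡-Reasoning
... | no y≢x rewrite filter-accept (_≢? x) {xs = ys} y≢x with sum-remove x u
...   | inj₁ e = inj₁ (cong (p y +_) e)
...   | inj₂ e = inj₂ (trans (cong (p y +_) e) (x∙yz≈y∙xz (p y) (p x) _))

representable≤-suc⁻ : ∀ {k n} → Representable≤ (suc k) n →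
  Representable≤ k n ⊎ ∃ λ m → Representable≤ k m × n ≡ p (suc k) + m
representable≤-suc⁻ {k} (S , u , pos , bnd , refl) =
  [ (λ e → inj₁ (S′ , u′ , pos′ , bnd′ , sym e))
  , (λ e → inj₂ (_ , (S′ , u′ , pos′ , bnd′ , refl) , e))
  ] (sum-remove (suc k) u)
  where
  S′ = remove (suc k) S
  u′ : Unique S′
  u′ = Unique.filter⁺ (_≢? suc k) u
  pos′ : All (1 ≤_) S′
  pos′ = filter⁺ (_≢? suc k) pos
  bnd′ : All (_≤ k) S′
  bnd′ = All.zipWith (λ (j≤1+k , j≢1+k) → ≤-pred (≤∧≢⇒< j≤1+k j≢1+k))
                     (filter⁺ (_≢? suc k) bnd , all-filter (_≢? suc k) S)

representable⇒representable≤ : ∀ k {n} → n < p (suc k) → Representable n → Representable≤ k n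
representable⇒representable≤ k n<p (S , u , pos , refl) = S , u , pos , indicesBounded S n<p , refl
  where
  indicesBounded : ∀ S → sum (map p S) < p (suc k) → All (_≤ k) S
  indicesBounded []      _  = []
  indicesBounded (j ∷ S) lt =
    ≮⇒≥ (λ k<j → <⇒≱ lt (≤-trans (p-mono-≤ k<j) (m≤m+n (p j) _))) ∷
    indicesBounded S (≤-<-trans (m≤n+m _ (p j)) lt)

Covers : ℕ → ℕ → ℕ → Set
Covers k l u = ∀ {n} → l ≤ n → n ≤ u → Representable≤ k n

covers-zero : Covers 0 0 0
covers-zero _ n≤0 rewrite n≤0⇒n≡0 n≤0 = [] , [] , [] , [] , refl

covers-weaken : ∀ {k l u} → Covers k l u → Covers (suc k) l u
covers-weaken c l≤n n≤u = representable≤-weaken (c l≤n n≤u)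

covers-shrink : ∀ {k l u l′ u′} → l ≤ l′ → u′ ≤ u → Covers k l u → Covers k l′ u′
covers-shrink l≤l′ u′≤u c l′≤n n≤u′ = c (≤-trans l≤l′ l′≤n) (≤-trans n≤u′ u′≤u)

covers-shift : ∀ {k l u} → Covers k l u → Covers (suc k) (l + p (suc k)) (u + p (suc k))
covers-shift {k} {l} {u} c {n} l+a≤n n≤u+a =
  subst (Representable≤ (suc k)) (m+[n∸m]≡n a≤n) (representable≤-add (c l≤n∸a n∸a≤u))
  where
  a = p (suc k)
  a≤n : a ≤ n
  a≤n = ≤-trans (m≤n+m a l) l+a≤n
  l≤n∸a : l ≤ n ∸ a
  l≤n∸a = m+n≤o⇒m≤o∸n l l+a≤n
  n∸a≤u : n ∸ a ≤ u
  n∸a≤u = subst (n ∸ a ≤_) (m+n∸n≡m u a) (∸-monoˡ-≤ a n≤u+a)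

covers-join : ∀ {k l u l′ u′} → Covers k l u → Covers k l′ u′ → l′ ≤ suc u → Covers k l (u ⊔ u′)
covers-join {u = u} {u′ = u′} c c′ l′≤1+u {n} l≤n n≤u⊔u′ with n ≤? u
... | yes n≤u = c l≤n n≤u
... | no  n≰u = c′ (≤-trans l′≤1+u (≰⇒> n≰u)) n≤u′
  where
  n≤u′ : n ≤ u′
  n≤u′ = [ (λ e → contradiction (subst (n ≤_) e n≤u⊔u′) n≰u) , (λ e → subst (n ≤_) e n≤u⊔u′) ] (⊔-sel u u′)

covers-extend : ∀ {k l u} → Covers k l u → l + p (suc k) ≤ suc u → Covers (suc k) l (u + p (suc k))
covers-extend {u = u} c h =
  subst (Covers _ _) (m≤n⇒m⊔n≡n (m≤m+n u _)) (covers-join (covers-weaken c) (covers-shift c) h)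

richert : ∀ {k l u} → 4 ≤ k → Covers k l u → l + p (suc k) ≤ suc u → ∀ n → l ≤ n → Representable n
richert {l = l} {u = u} 4≤k c h n l≤n = go n 4≤k c h (m≤n+m n u)
  where
  go : ∀ t {k u} → 4 ≤ k → Covers k l u → l + p (suc k) ≤ suc u → n ≤ u + t → Representable n
  go zero    _   c _ n≤u = representable≤⇒representable (c l≤n (subst (n ≤_) (+-identityʳ _) n≤u))
  go (suc t) {k} {u} 4≤k c h n≤u+1+t = go t (m≤n⇒m≤1+n 4≤k) (covers-extend c h) h′ n≤u′+t
    where
    open ≤-Reasoning
    a = p (suc k)
    h′ : l + p (suc (suc k)) ≤ suc (u + a)
    h′ = begin
      l + p (suc (suc k)) ≤⟨ +-monoʳ-≤ l (p-suc≤2*p (m≤n⇒m≤1+n 4≤k)) ⟩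
      l + 2 * a          ≡⟨ cong (l +_) (cong (a +_) (+-identityʳ a)) ⟩
      l + (a + a)        ≡⟨ +-assoc l a a ⟨
      l + a + a          ≤⟨ +-monoˡ-≤ a h ⟩
      suc u + a          ∎
    n≤u′+t : n ≤ u + a + t
    n≤u′+t = begin
      n               ≤⟨ n≤u+1+t ⟩
      u + suc t       ≡⟨ +-suc u t ⟩
      suc u + t       ≡⟨ cong (_+ t) (+-comm 1 u) ⟩
      u + 1 + t       ≤⟨ +-monoˡ-≤ t (+-monoʳ-≤ u (p-positive (suc k))) ⟩
      u + a + t       ∎

Interval : Set
Interval = ℕ × ℕ

CoversInterval : ℕ → Interval → Set
CoversInterval k (l , u) = Covers k l u

shift : ℕ → List Interval → List Interval
shift a = map λ (l , u) → l + a , u + a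

mergeByLower : List Interval → List Interval → List Interval
mergeByLower = merge {R = λ (l , _) (l′ , _) → l ≤ l′} (λ (l , _) (l′ , _) → l ≤? l′)

-- _⊔′_ and _⊓′_ compare with the builtin _<ᵇ_, unlike _⊔_ and _⊓_ which recurse in unary.
coalesceFrom : Interval → List Interval → List Interval
coalesceFrom i       []                 = i ∷ []
coalesceFrom (l , u) ((l′ , u′) ∷ is) with l′ ≤? suc u
... | yes _ = coalesceFrom (l , u ⊔′ u′) is
... | no  _ = (l , u) ∷ coalesceFrom (l′ , u′) is

coalesce : List Interval → List Interval
coalesce []       = []
coalesce (i ∷ is) = coalesceFrom i is

-- Intervals are sorted by lower endpoint, so everything after the first one starting above b is dropped.
truncate : ℕ → List Interval → List Interval
truncate b []             = []
truncate b ((l , u) ∷ is) with l ≤? b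
... | yes _ = (l , u ⊓′ b) ∷ truncate b is
... | no  _ = []

-- The previous list is passed as an argument so that it is evaluated once, not twice.
addSummand : ℕ → ℕ → List Interval → List Interval
addSummand b a is = truncate b (coalesce (mergeByLower is (shift a is)))

coveredIntervals : ℕ → ℕ → List Interval
coveredIntervals b zero    = (0 , 0) ∷ []
coveredIntervals b (suc k) = addSummand b (p (suc k)) (coveredIntervals b k)

module _ {k : ℕ} where

  mergeByLower-covers : ∀ {is js} → All (CoversInterval k) is → All (CoversInterval k) js →
                        All (CoversInterval k) (mergeByLower is js)
  mergeByLower-covers {is} {js} cis cjs = All-resp-↭ (↭-sym (merge-↭ _ is js)) (++⁺ cis cjs)

  coalesceFrom-covers : ∀ {i is} → CoversInterval k i → All (CoversInterval k) is →
                        All (CoversInterval k) (coalesceFrom i is)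
  coalesceFrom-covers c [] = c ∷ []
  coalesceFrom-covers {l , u} {(l′ , u′) ∷ is} c (c′ ∷ cs) with l′ ≤? suc u
  ... | yes l′≤1+u = coalesceFrom-covers (subst (Covers k l) (⊔≡⊔′ u u′) (covers-join c c′ l′≤1+u)) cs
  ... | no  _      = c ∷ coalesceFrom-covers c′ cs

  coalesce-covers : ∀ {is} → All (CoversInterval k) is → All (CoversInterval k) (coalesce is)
  coalesce-covers []       = []
  coalesce-covers (c ∷ cs) = coalesceFrom-covers c cs

  truncate-covers : ∀ b {is} → All (CoversInterval k) is → All (CoversInterval k) (truncate b is)
  truncate-covers b [] = []
  truncate-covers b {(l , u) ∷ is} (c ∷ cs) with l ≤? b
  ... | yes _ = covers-shrink ≤-refl (subst (_≤ u) (⊓≡⊓′ u b) (m⊓n≤m u b)) c ∷ truncate-covers b cs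
  ... | no  _ = []

addSummand-covers : ∀ b {k is} → All (CoversInterval k) is →
                    All (CoversInterval (suc k)) (addSummand b (p (suc k)) is)
addSummand-covers b cs =
  truncate-covers b (coalesce-covers (mergeByLower-covers
    (All.map covers-weaken cs) (map⁺ (All.map covers-shift cs))))

coveredIntervals-sound : ∀ b k → All (CoversInterval k) (coveredIntervals b k)
coveredIntervals-sound b zero    = covers-zero ∷ []
coveredIntervals-sound b (suc k) = addSummand-covers b (coveredIntervals-sound b k)

_⊇_ : Interval → Interval → Set
(l′ , u′) ⊇ (l , u) = l′ ≤ l × u ≤ u′

_⊇?_ : ∀ i j → Dec (i ⊇ j)
(l′ , u′) ⊇? (l , u) = (l′ ≤? l) ×-dec (u ≤? u′)

covers-fromIntervals : ∀ {k l u is} → All (CoversInterval k) is → Any (_⊇ (l , u)) is → Covers k l u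
covers-fromIntervals cs i {n} = lookupWith (λ c (l′≤l , u≤u′) → covers-shrink l′≤l u≤u′ c {n}) cs i

pSum : ℕ → ℕ
pSum zero    = 0
pSum (suc k) = p (suc k) + pSum k

-- The comparison with pSum only prunes the search.
isSumOfDistinct : ℕ → ℕ → Bool
isSumOfDistinct zero    n = n ≡ᵇ 0
isSumOfDistinct (suc k) n =
  (n ≤ᵇ pSum (suc k)) ∧
  (((p (suc k) ≤ᵇ n) ∧ isSumOfDistinct k (n ∸ p (suc k))) ∨ isSumOfDistinct k n)

representable≤⇒≤pSum : ∀ k {n} → Representable≤ k n → n ≤ pSum k
representable≤⇒≤pSum zero    r = ≤-reflexive (representable≤-zero⁻ r)
representable≤⇒≤pSum (suc k) r with representable≤-suc⁻ r
... | inj₁ r′              = ≤-trans (representable≤⇒≤pSum k r′) (m≤n+m _ _)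
... | inj₂ (_ , r′ , refl) = +-monoʳ-≤ (p (suc k)) (representable≤⇒≤pSum k r′)

representable≤⇒isSumOfDistinct : ∀ k {n} → Representable≤ k n → T (isSumOfDistinct k n)
representable≤⇒isSumOfDistinct zero r rewrite representable≤-zero⁻ r = _
representable≤⇒isSumOfDistinct (suc k) r =
  from T-∧ (≤⇒≤ᵇ (representable≤⇒≤pSum (suc k) r) , lastIndex (representable≤-suc⁻ r))
  where
  a = p (suc k)
  lastIndex : ∀ {n} → Representable≤ k n ⊎ ∃ (λ m → Representable≤ k m × n ≡ a + m) →
              T (((a ≤ᵇ n) ∧ isSumOfDistinct k (n ∸ a)) ∨ isSumOfDistinct k n)
  lastIndex (inj₁ r′)              = from T-∨ (inj₂ (representable≤⇒isSumOfDistinct k r′))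
  lastIndex (inj₂ (m , r′ , refl)) = from T-∨ (inj₁ (from T-∧
    (≤⇒≤ᵇ (m≤m+n a m) , subst (T ∘ isSumOfDistinct k) (sym (m+n∸m≡n a m)) (representable≤⇒isSumOfDistinct k r′))))

291217-unrepresentable : ¬ Representable 291217
291217-unrepresentable r =
  representable≤⇒isSumOfDistinct 29 (representable⇒representable≤ 29 (≤ᵇ⇒≤ _ _ _) r)

covers-291218-492593 : Covers 26 291218 492593
covers-291218-492593 = covers-fromIntervals (coveredIntervals-sound 492593 26)
  (toWitness {a? = any? (_⊇? (291218 , 492593)) (coveredIntervals 492593 26)} _)

mainTheorem4 : ¬ Representable 291217 × ((n : ℕ) → 291217 < n → Representable n)
mainTheorem4 =
  291217-unrepresentable , richert (≤ᵇ⇒≤ 4 26 _) covers-291218-492593 (≤ᵇ⇒≤ _ _ _)
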